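{- There exists an always connected periodic graph $\mathcal{G}=(G_0,\dots,G_{p-1})$ with footprint $G$ such that $c(G)=1$, $c(G_i)=2$ for every $0\le i\le p-1$, and $c(\mathcal{G})=2$.
   Context: All graphs are finite, undirected and reflexive. A periodic graph with period $p\ge1$ is a sequence $\mathcal{G}=(G_0,\dots,G_{p-1})$ of graphs $G_i=(V,E_i)$ on a common vertex set, extended by $G_{i+p}=G_i$; its footprint is $G=(V,\bigcup_iE_i)$, assumed connected. It is always connected if every snapshot $G_i$ is connected. Cops and Robber on a periodic graph with $k$ cops (perfect information): cops choose starting vertices, then the robber; in each round $t=0,1,\dots$ each cop moves to a vertex of $N_{G_{t\bmod p}}[\text{its position}]$, then the robber likewise; the cops win if a cop ever moves onto the robber's vertex. The cop number $c(\cdot)$ is the least $k$ such that $k$ cops have a winning strategy; a static graph is a periodic graph of period $1$. -}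

module Defs where

open import Data.Nat using (ℕ; zero; suc; _<_)
open import Data.Nat.DivMod using (_mod_)
open import Data.Fin as F using (Fin)
open import Data.Bool using (Bool; true; false; T; _∨_)
open import Data.Product using (Σ; ∃; ∃-syntax; _×_; _,_)
open import Data.Sum using (_⊎_)
open import Relation.Binary.PropositionalEquality using (_≡_; subst)
open import Relation.Nullary using (¬_)

record Graph (n : ℕ) : Set where
  field
    adj    : Fin n → Fin n → Bool
    adjRef : ∀ u → T (adj u u)
    adjSym : ∀ u v → T (adj u v) → T (adj v u)
open Graph public

_∋_~_ : ∀ {n} → Graph n → Fin n → Fin n → Set
G ∋ u ~ v = T (adj G u v)

data Reach {n} (G : Graph n) (u : Fin n) : Fin n → Set where
  here : Reach G u u
  step : ∀ {v w} → Reach G u v → G ∋ v ~ w → Reach G u w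

Connected : ∀ {n} → Graph n → Set
Connected G = ∀ u v → Reach G u v

record Periodic (n : ℕ) : Set where
  field
    q    : ℕ
    snap : Fin (suc q) → Graph n
open Periodic public

period : ∀ {n} → Periodic n → ℕ
period 𝒢 = suc (q 𝒢)

at : ∀ {n} → Periodic n → ℕ → Graph n
at 𝒢 t = snap 𝒢 (t mod suc (q 𝒢))

static : ∀ {n} → Graph n → Periodic n
static G = record { q = zero ; snap = λ _ → G }

AlwaysConnected : ∀ {n} → Periodic n → Set
AlwaysConnected 𝒢 = ∀ i → Connected (snap 𝒢 i)

anyFin : ∀ {m} → (Fin m → Bool) → Bool
anyFin {zero}  f = false
anyFin {suc m} f = f F.zero ∨ anyFin (λ i → f (F.suc i))

private
  ∨-introˡ : ∀ a b → T a → T (a ∨ b)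
  ∨-introˡ true b t = t
  ∨-introʳ : ∀ a b → T b → T (a ∨ b)
  ∨-introʳ true  b t = _
  ∨-introʳ false b t = t

  anySym : ∀ {n m} (S : Fin m → Graph n) u v →
           T (anyFin (λ i → adj (S i) u v)) → T (anyFin (λ i → adj (S i) v u))
  anySym {m = zero} S u v ()
  anySym {m = suc m} S u v h with adj (S F.zero) u v in eq
  ... | true  = ∨-introˡ _ _ (adjSym (S F.zero) u v (subst T (Relation.Binary.PropositionalEquality.sym eq) _))
    where import Relation.Binary.PropositionalEquality
  ... | false = ∨-introʳ (adj (S F.zero) v u) _ (anySym (λ i → S (F.suc i)) u v h)

footprint : ∀ {n} → Periodic n → Graph n
footprint 𝒢 = record
  { adj    = λ u v → anyFin (λ i → adj (snap 𝒢 i) u v)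
  ; adjRef = λ u → ∨-introˡ _ _ (adjRef (snap 𝒢 F.zero) u)
  ; adjSym = λ u v → anySym (snap 𝒢) u v
  }

-- Inductive (least
-- fixed point), i.e. the cops' winning region of this finite
-- perfect-information reachability game.

data CopsWinFrom {n k} (𝒢 : Periodic n) (t : ℕ)
                 (c : Fin k → Fin n) (r : Fin n) : Set where
  win : (c' : Fin k → Fin n) →
        (∀ i → at 𝒢 t ∋ c i ~ c' i) →
        ((∃[ i ] c' i ≡ r) ⊎
         (∀ r' → at 𝒢 t ∋ r ~ r' → CopsWinFrom 𝒢 (suc t) c' r')) →
        CopsWinFrom 𝒢 t c r

CopsWin : ∀ {n} → Periodic n → ℕ → Set
CopsWin {n} 𝒢 k = ∃[ c ] ((r : Fin n) → CopsWinFrom {n} {k} 𝒢 0 c r)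

CopNumber : ∀ {n} → Periodic n → ℕ → Set
CopNumber 𝒢 k = CopsWin 𝒢 k × (∀ j → j < k → ¬ CopsWin 𝒢 j)

-- Both snapshots are complete bipartite graphs on five vertices,
-- K_{{0,1},{2,3,4}} and K_{{3,4},{0,1,2}}.  In such a graph two cops, one on
-- each side, dominate everything, while a single cop is evaded by a robber who
-- always stands on the cop's side at another vertex.  Vertex 2 lies on the
-- large side of both snapshots, hence is adjacent to everything in the
-- footprint.  Against the periodic graph the robber plays the same evasion but
-- never stands on 2.
module Submission where

open import Defs
open import Data.Nat using (ℕ; zero; suc; _≤_; _≤′_; ≤′-refl; ≤′-step; s≤s⁻¹)
open import Data.Nat.DivMod using (_mod_)
open import Data.Nat.Properties using (≤⇒≤′)
open import Data.Fin using (Fin; zero; suc; _≟_)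
open import Data.Fin.Properties using (all?; any?)
open import Data.Bool using (Bool; true; false; T; if_then_else_)
import Data.Bool.Properties as Bool
open import Data.Vec.Functional using ([]; _∷_)
open import Data.Product using (Σ; ∃-syntax; _×_; _,_)
open import Data.Sum using (_⊎_; inj₁; inj₂)
open import Data.Unit using (tt)
open import Function using (_∘_)
open import Relation.Nullary using (¬_; Dec; yes; no)
open import Relation.Nullary.Decidable
  using (⌊_⌋; T?; ¬?; _×-dec_; _⊎-dec_; _→-dec_; toWitness; fromWitness)
open import Relation.Binary.PropositionalEquality
  using (_≡_; _≢_; refl; sym; trans; subst)

private
  variable
    n k : ℕ

Reach-++ : ∀ {G : Graph n} {u v w} → Reach G u v → Reach G v w → Reach G u w
Reach-++ p here       = p
Reach-++ p (step q e) = step (Reach-++ p q) e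

Reach-reverse : ∀ {G : Graph n} {u v} → Reach G u v → Reach G v u
Reach-reverse here = here
Reach-reverse {G = G} (step {v} {w} p e) =
  Reach-++ (step here (adjSym G v w e)) (Reach-reverse p)

reachableFrom⇒Connected : ∀ (G : Graph n) h → (∀ v → Reach G h v) → Connected G
reachableFrom⇒Connected G h reach u v = Reach-++ (Reach-reverse (reach u)) (reach v)

BipartiteAdj : (Fin n → Bool) → Fin n → Fin n → Set
BipartiteAdj side u v = u ≡ v ⊎ side u ≢ side v

bipartiteAdj? : (side : Fin n → Bool) → ∀ u v → Dec (BipartiteAdj side u v)
bipartiteAdj? side u v = (u ≟ v) ⊎-dec ¬? (side u Bool.≟ side v)

bipartite : (Fin n → Bool) → Graph n
bipartite side = record
  { adj    = λ u v → ⌊ bipartiteAdj? side u v ⌋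
  ; adjRef = λ u → fromWitness {a? = bipartiteAdj? side u u} (inj₁ refl)
  ; adjSym = λ u v uv → fromWitness {a? = bipartiteAdj? side v u}
      (Data.Sum.map sym (_∘ sym) (toWitness {a? = bipartiteAdj? side u v} uv))
  }

module _ (side : Fin n → Bool) where

  bipartite-adj⁺ : ∀ {u v} → side u ≢ side v → bipartite side ∋ u ~ v
  bipartite-adj⁺ {u} {v} = fromWitness {a? = bipartiteAdj? side u v} ∘ inj₂

  bipartite-adj⁻ : ∀ {u v} → bipartite side ∋ u ~ v → BipartiteAdj side u v
  bipartite-adj⁻ {u} {v} = toWitness {a? = bipartiteAdj? side u v}

  bipartite-adj-either : ∀ {a b} → side a ≢ side b →
                         ∀ r → bipartite side ∋ a ~ r ⊎ bipartite side ∋ b ~ r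
  bipartite-adj-either {a} {b} a≢b r = by-side (side a Bool.≟ side r)
    where
    by-side : Dec (side a ≡ side r) → bipartite side ∋ a ~ r ⊎ bipartite side ∋ b ~ r
    by-side (yes a≡r) = inj₂ (bipartite-adj⁺ (a≢b ∘ trans a≡r ∘ sym))
    by-side (no  a≢r) = inj₁ (bipartite-adj⁺ a≢r)

  bipartite-connected : ∀ {a b} → side a ≢ side b → Connected (bipartite side)
  bipartite-connected {a} {b} a≢b = reachableFrom⇒Connected _ a reach
    where
    reach : ∀ v → Reach (bipartite side) a v
    reach v with bipartite-adj-either a≢b v
    ... | inj₁ a~v = step here a~v
    ... | inj₂ b~v = step (step here (bipartite-adj⁺ a≢b)) b~v

approach : Graph n → Fin n → Fin n → Fin n
approach G r u = if adj G u r then r else u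

approach-adj : ∀ (G : Graph n) r u → G ∋ u ~ approach G r u
approach-adj G r u with adj G u r in eq
... | true  = subst T (sym eq) _
... | false = adjRef G u

approach-captures : ∀ (G : Graph n) {r u} → G ∋ u ~ r → approach G r u ≡ r
approach-captures G {r} {u} u~r with adj G u r
... | true = refl

dominating⇒CopsWin : ∀ (P : Periodic n) (c : Fin k → Fin n) →
                     (∀ r → ∃[ i ] at P 0 ∋ c i ~ r) → CopsWin P k
dominating⇒CopsWin P c dominating = c , λ r →
  let (i , cᵢ~r) = dominating r in
  win (approach (at P 0) r ∘ c) (approach-adj (at P 0) r ∘ c)
      (inj₁ (i , approach-captures (at P 0) cᵢ~r))

stay-∷ : ∀ (G : Graph n) v {c c' : Fin k → Fin n} →
         (∀ i → G ∋ c i ~ c' i) → ∀ i → G ∋ (v ∷ c) i ~ (v ∷ c') i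
stay-∷ G v moves zero    = adjRef G v
stay-∷ G v moves (suc i) = moves i

CopsWinFrom-suc : ∀ {P : Periodic n} {t c r} v →
                  CopsWinFrom {n} {k} P t c r → CopsWinFrom P t (v ∷ c) r
CopsWinFrom-suc {P = P} {t} v (win c' moves (inj₁ (i , cᵢ≡r))) =
  win (v ∷ c') (stay-∷ (at P t) v moves) (inj₁ (suc i , cᵢ≡r))
CopsWinFrom-suc {P = P} {t} v (win c' moves (inj₂ next)) =
  win (v ∷ c') (stay-∷ (at P t) v moves) (inj₂ λ r' r~r' → CopsWinFrom-suc v (next r' r~r'))

CopsWin-mono : ∀ {P : Periodic (suc n)} {j} → j ≤ k → CopsWin P j → CopsWin P k
CopsWin-mono {P = P} = go ∘ ≤⇒≤′
  where
  go : ∀ {j k} → j ≤′ k → CopsWin P j → CopsWin P k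
  go ≤′-refl        w       = w
  go (≤′-step j≤′k) w with go j≤′k w
  ... | c , wins = zero ∷ c , λ r → CopsWinFrom-suc zero (wins r)

CopNumber-intro : ∀ {P : Periodic (suc n)} →
                  CopsWin P (suc k) → ¬ CopsWin P k → CopNumber P (suc k)
CopNumber-intro win-suc lose-k = win-suc , λ j j<1+k → lose-k ∘ CopsWin-mono (s≤s⁻¹ j<1+k)

¬CopsWinFrom-zero : ∀ (P : Periodic n) {t c r} → ¬ CopsWinFrom {n} {0} P t c r
¬CopsWinFrom-zero P     (win c' moves (inj₁ (() , _)))
¬CopsWinFrom-zero P {t} {r = r} (win c' moves (inj₂ next)) =
  ¬CopsWinFrom-zero P (next r (adjRef (at P t) r))

¬CopsWin-zero : ∀ (P : Periodic (suc n)) → ¬ CopsWin P 0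
¬CopsWin-zero P (c , wins) = ¬CopsWinFrom-zero P (wins zero)

Evades : Graph n → (Fin n → Fin n → Set) → (Fin n → Fin n → Set) → Set
Evades G Safe Safe' = ∀ c r → Safe c r → ∀ c' → G ∋ c ~ c' →
                      c' ≢ r × ∃[ r' ] (G ∋ r ~ r' × Safe' c' r')

evades? : ∀ (G : Graph n) {Safe Safe'} →
          (∀ c r → Dec (Safe c r)) → (∀ c r → Dec (Safe' c r)) → Dec (Evades G Safe Safe')
evades? G safe? safe'? =
  all? λ c → all? λ r → safe? c r →-dec all? λ c' → T? (adj G c c') →-dec
    (¬? (c' ≟ r) ×-dec any? λ r' → T? (adj G r r') ×-dec safe'? c' r')

module _ (P : Periodic n) (Safe : ℕ → Fin n → Fin n → Set)
         (evades : ∀ t → Evades (at P t) (Safe t) (Safe (suc t))) where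

  evasion⇒¬CopsWinFrom : ∀ {t c r} → Safe t (c zero) r → ¬ CopsWinFrom {n} {1} P t c r
  evasion⇒¬CopsWinFrom {t} {r = r} safe (win c' moves caught)
    with evades t _ r safe (c' zero) (moves zero) | caught
  ... | c'≢r , _                 | inj₁ (zero , c'≡r) = c'≢r c'≡r
  ... | _    , r' , r~r' , safe' | inj₂ next          = evasion⇒¬CopsWinFrom safe' (next r' r~r')

  evasion⇒¬CopsWin : (∀ c → ∃[ r ] Safe 0 c r) → ¬ CopsWin P 1
  evasion⇒¬CopsWin start (c , wins) =
    let (r , safe) = start (c zero) in evasion⇒¬CopsWinFrom safe (wins r)

SameSide : (Fin n → Bool) → Fin n → Fin n → Set
SameSide side c r = r ≢ c × side r ≡ side c

sameSide? : (side : Fin n → Bool) → ∀ c r → Dec (SameSide side c r)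
sameSide? side c r = ¬? (r ≟ c) ×-dec (side r Bool.≟ side c)

module _ (side : Fin n → Bool) (partner : ∀ v → ∃[ w ] SameSide side v w) where

  bipartite-evades : Evades (bipartite side) (SameSide side) (SameSide side)
  bipartite-evades c r (r≢c , sr≡sc) c' c~c' with bipartite-adj⁻ side c~c'
  ... | inj₁ refl = r≢c ∘ sym , r , adjRef (bipartite side) r , r≢c , sr≡sc
  ... | inj₂ sc≢sc' =
    let (w , w≢c' , sw≡sc') = partner c' in
    (λ { refl → sc≢sc' (sym sr≡sc) }) ,
    w , bipartite-adj⁺ side (λ sr≡sw → sc≢sc' (trans (sym sr≡sc) (trans sr≡sw sw≡sc'))) ,
    w≢c' , sw≡sc'

  bipartite-¬CopsWin₁ : ¬ CopsWin (static (bipartite side)) 1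
  bipartite-¬CopsWin₁ = evasion⇒¬CopsWin _ (λ _ → SameSide side) (λ _ → bipartite-evades) partner

pattern v0 = zero
pattern v1 = suc zero
pattern v2 = suc (suc zero)
pattern v3 = suc (suc (suc zero))
pattern v4 = suc (suc (suc (suc zero)))

side : Fin 2 → Fin 5 → Bool
side zero       v0 = true
side zero       v1 = true
side (suc zero) v3 = true
side (suc zero) v4 = true
side _          _  = false

𝒢 : Periodic 5
𝒢 = record { q = 1 ; snap = λ i → bipartite (side i) }

corner : Fin 2 → Fin 5
corner zero       = v0
corner (suc zero) = v3

corner-opposite : ∀ i → side i (corner i) ≢ side i v2
corner-opposite zero       ()
corner-opposite (suc zero) ()

partner : ∀ i v → ∃[ w ] SameSide (side i) v w
partner = toWitness {a? = all? λ i → all? λ v → any? λ w → sameSide? (side i) v w} tt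

-- Avoiding 2, the robber's side is one of {0,1} and {3,4}, which are sides in
-- both snapshots, so the change of snapshot never strands him.
Hidden : Fin 2 → Fin 5 → Fin 5 → Set
Hidden i c r = SameSide (side i) c r × r ≢ v2

hidden? : ∀ i c r → Dec (Hidden i c r)
hidden? i c r = sameSide? (side i) c r ×-dec ¬? (r ≟ v2)

hidden-evades : ∀ t → Evades (at 𝒢 t) (Hidden (t mod 2)) (Hidden (suc t mod 2))
hidden-evades 0             = toWitness {a? = evades? (snap 𝒢 v0) (hidden? v0) (hidden? v1)} tt
hidden-evades 1             = toWitness {a? = evades? (snap 𝒢 v1) (hidden? v1) (hidden? v0)} tt
hidden-evades (suc (suc t)) = hidden-evades t

hidden-start : ∀ c → ∃[ r ] Hidden v0 c r
hidden-start = toWitness {a? = all? λ c → any? λ r → hidden? v0 c r} tt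

snapshot-dominated : ∀ i r → ∃[ j ] snap 𝒢 i ∋ (corner i ∷ v2 ∷ []) j ~ r
snapshot-dominated i r with bipartite-adj-either (side i) (corner-opposite i) r
... | inj₁ corner~r = zero , corner~r
... | inj₂ v2~r     = suc zero , v2~r

footprint-hub : ∀ r → footprint 𝒢 ∋ v2 ~ r
footprint-hub = toWitness {a? = all? λ r → T? (adj (footprint 𝒢) v2 r)} tt

lemma6 : ∃[ n ] Σ (Periodic n) (λ 𝒢 →
           AlwaysConnected 𝒢 ×
           CopNumber (static (footprint 𝒢)) 1 ×
           (∀ i → CopNumber (static (snap 𝒢 i)) 2) ×
           CopNumber 𝒢 2)
lemma6 = 5 , 𝒢 , connected , footprint-copNumber , snapshot-copNumber , periodic-copNumber
  where
  connected : AlwaysConnected 𝒢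
  connected i = bipartite-connected (side i) (corner-opposite i)

  footprint-copNumber : CopNumber (static (footprint 𝒢)) 1
  footprint-copNumber = CopNumber-intro
    (dominating⇒CopsWin _ (λ _ → v2) (λ r → zero , footprint-hub r))
    (¬CopsWin-zero _)

  snapshot-copNumber : ∀ i → CopNumber (static (snap 𝒢 i)) 2
  snapshot-copNumber i = CopNumber-intro
    (dominating⇒CopsWin _ _ (snapshot-dominated i))
    (bipartite-¬CopsWin₁ (side i) (partner i))

  periodic-copNumber : CopNumber 𝒢 2
  periodic-copNumber = CopNumber-intro
    (dominating⇒CopsWin 𝒢 _ (snapshot-dominated zero))
    (evasion⇒¬CopsWin 𝒢 (λ t → Hidden (t mod 2)) hidden-evades hidden-start)
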